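{- Let $0\le r<n$. The simplicial complex $\mathcal{J}_{n,r}$ is the clique complex of the graph $\mathcal{G}$ whose vertex set is the vertex set of $\mathcal{J}_{n,r}$, two vertices being adjacent iff the pair satisfies the modified admissibility condition.
   Context: Identify $Q_n=\{0,1\}^n$ with $\{0,\ldots,2^n-1\}$ via binary expansion, with Hamming distance $d_H$ and $\overline a$ the bitwise complement of $a$. The simplicial complex $\mathcal{J}_{n,r}$ has as vertices the symbols $e_{(a,b)}$, $a<b$, with $r<d_H(a,b)<n$; a set $\{e_{(a_1,b_1)},\ldots,e_{(a_t,b_t)}\}$ spans a simplex iff it satisfies the modified admissibility condition: for no $0\le a<2^{n-1}$ does $x_ax_{\overline a}$ divide $x_{a_1}x_{b_1}\cdots x_{a_t}x_{b_t}$ (a product of commuting variables). -}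

module Defs where

open import Data.Nat using (ℕ; zero; suc; _+_; _*_; _∸_; _^_; _<_; _≤_; _≡ᵇ_)
open import Data.Nat.DivMod using (_/_; _%_)
open import Data.Bool using (if_then_else_)
open import Data.List using (List; []; _∷_; concatMap)
open import Data.Product using (_×_; _,_)
open import Relation.Nullary using (¬_)
open import Relation.Binary.PropositionalEquality using (_≡_)

bit : ℕ → ℕ → ℕ
bit zero    a = a % 2
bit (suc i) a = bit i (a / 2)

sumBelow : ℕ → (ℕ → ℕ) → ℕ
sumBelow zero    f = 0
sumBelow (suc n) f = sumBelow n f + f n

-- Hamming distance in Q_n = {0,1}^n (first n binary digits)
dH : ℕ → ℕ → ℕ → ℕ
dH n a b = sumBelow n (λ i → if bit i a ≡ᵇ bit i b then 0 else 1)

comp : ℕ → ℕ → ℕ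
comp n a = sumBelow n (λ i → (1 ∸ bit i a) * 2 ^ i)

IsVertex : ℕ → ℕ → ℕ × ℕ → Set
IsVertex n r (a , b) = (a < b) × (b < 2 ^ n) × (r < dH n a b) × (dH n a b < n)

-- the indices of the variables in the monomial x_{a1} x_{b1} ... x_{at} x_{bt}
endpoints : List (ℕ × ℕ) → List ℕ
endpoints = concatMap (λ { (a , b) → a ∷ b ∷ [] })

occ : ℕ → List ℕ → ℕ
occ c []       = 0
occ c (x ∷ xs) = (if x ≡ᵇ c then 1 else 0) + occ c xs

-- monomial divisibility: a monomial is given by the list of its variable
-- indices (with multiplicity); M ∣ N iff every exponent in M is ≤ that in N
MonDivides : List ℕ → List ℕ → Set
MonDivides M N = ∀ c → occ c M ≤ occ c N

Admissible : ℕ → List (ℕ × ℕ) → Set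
Admissible n S = ∀ a → a < 2 ^ (n ∸ 1) → ¬ MonDivides (a ∷ comp n a ∷ []) (endpoints S)

-- Only two endpoints matter for a divisibility x_a x_ā ∣ x_{a₁} x_{b₁} ⋯ x_{a_t} x_{b_t}:
-- since a ≠ ā, it holds iff a and ā both occur as endpoints.  If they are endpoints of two
-- different vertices, that edge already violates admissibility; they cannot be the two ends
-- of a single vertex, because d_H(a, ā) = n while every vertex has d_H < n.
module Submission where

open import Data.Bool using (true; false; if_then_else_)
open import Data.Bool.Properties using (T-≡; ¬-not)
open import Data.Empty using (⊥-elim)
open import Data.List using (List; []; _∷_; _++_)
open import Data.List.Membership.Propositional using (_∈_)
open import Data.List.Membership.Propositional.Properties using (∈-++⁺ˡ; ∈-++⁺ʳ; ∈-++⁻)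
open import Data.List.Relation.Unary.All as All using (All)
open import Data.List.Relation.Unary.Any using (here; there)
open import Data.List.Relation.Unary.Unique.Propositional using (Unique)
open import Data.Nat
open import Data.Nat.Divisibility using (n∣m*n)
open import Data.Nat.DivMod
open import Data.Nat.Properties
open import Data.Product using (_×_; _,_; ∃-syntax)
open import Data.Product.Properties using (≡-dec)
open import Data.Sum using (inj₁; inj₂)
open import Function.Base using (_∘_)
open import Function.Bundles using (_⇔_; mk⇔; Equivalence)
open import Relation.Binary.PropositionalEquality
open import Relation.Nullary using (¬_; yes; no)
open import Defs

open ≡-Reasoning

≡ᵇ-refl : ∀ x → (x ≡ᵇ x) ≡ true
≡ᵇ-refl x = Equivalence.to T-≡ (≡⇒≡ᵇ x x refl)

≢⇒≡ᵇ≡false : ∀ {x y} → x ≢ y → (x ≡ᵇ y) ≡ false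
≢⇒≡ᵇ≡false {x} {y} x≢y = ¬-not (x≢y ∘ ≡ᵇ⇒≡ x y ∘ Equivalence.from T-≡)

1∸n<2 : ∀ n → 1 ∸ n < 2
1∸n<2 n = s≤s (m∸n≤m 1 n)

n≢1∸n : ∀ {n} → n < 2 → n ≢ 1 ∸ n
n≢1∸n {0}     _ ()
n≢1∸n {1}     _ ()
n≢1∸n {suc (suc _)} (s≤s (s≤s ()))

binary : ℕ → (ℕ → ℕ) → ℕ
binary n d = sumBelow n (λ i → d i * 2 ^ i)

binary-suc : ∀ n d → binary (suc n) d ≡ d 0 + binary n (d ∘ suc) * 2
binary-suc zero    d = trans (*-identityʳ (d 0)) (sym (+-identityʳ (d 0)))
binary-suc (suc n) d rewrite binary-suc n d = shift (d 0) (binary n (d ∘ suc)) (d (suc n)) (2 ^ n)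
  where
  open import Data.Nat.Tactic.RingSolver
  shift : ∀ d₀ x y p → d₀ + x * 2 + y * (2 * p) ≡ d₀ + (x + y * p) * 2
  shift = solve-∀

[d+2x]%2≡d : ∀ d x → d < 2 → (d + x * 2) % 2 ≡ d
[d+2x]%2≡d d x d<2 = trans ([m+kn]%n≡m%n d x 2) (m<n⇒m%n≡m d<2)

[d+2x]/2≡x : ∀ d x → d < 2 → (d + x * 2) / 2 ≡ x
[d+2x]/2≡x d x d<2 = begin
  (d + x * 2) / 2     ≡⟨ +-distrib-/-∣ʳ d (n∣m*n x) ⟩
  d / 2 + x * 2 / 2   ≡⟨ cong₂ _+_ (m<n⇒m/n≡0 d<2) (m*n/n≡m x 2) ⟩
  x                   ∎

bit-binary : ∀ n d → (∀ i → i < n → d i < 2) → ∀ i → i < n → bit i (binary n d) ≡ d i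
bit-binary (suc n) d digits zero _ rewrite binary-suc n d =
  [d+2x]%2≡d (d 0) (binary n (d ∘ suc)) (digits 0 z<s)
bit-binary (suc n) d digits (suc i) (s≤s i<n)
  rewrite binary-suc n d | [d+2x]/2≡x (d 0) (binary n (d ∘ suc)) (digits 0 z<s) =
  bit-binary n (d ∘ suc) (λ j j<n → digits (suc j) (s≤s j<n)) i i<n

bit<2 : ∀ i a → bit i a < 2
bit<2 zero    a = m%n<n a 2
bit<2 (suc i) a = bit<2 i (a / 2)

-- comp n a is definitionally binary n (λ j → 1 ∸ bit j a).
bit-comp : ∀ {n i} a → i < n → bit i (comp n a) ≡ 1 ∸ bit i a
bit-comp {n} {i} a = bit-binary n (λ j → 1 ∸ bit j a) (λ j _ → 1∸n<2 (bit j a)) i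

comp-≢ : ∀ {n} a → 0 < n → a ≢ comp n a
comp-≢ a 0<n a≡ā = n≢1∸n (bit<2 0 a) (trans (cong (bit 0) a≡ā) (bit-comp a 0<n))

sumBelow-ones : ∀ n f → (∀ i → i < n → f i ≡ 1) → sumBelow n f ≡ n
sumBelow-ones zero    f ones = refl
sumBelow-ones (suc n) f ones
  rewrite sumBelow-ones n f (λ i i<n → ones i (m<n⇒m<1+n i<n)) | ones n ≤-refl = +-comm n 1

dH≡n : ∀ n a b → (∀ i → i < n → bit i a ≢ bit i b) → dH n a b ≡ n
dH≡n n a b differ = sumBelow-ones n _ λ i i<n →
  cong (if_then 0 else 1) (≢⇒≡ᵇ≡false (differ i i<n))

dH-comp : ∀ n a → dH n a (comp n a) ≡ n
dH-comp n a = dH≡n n a (comp n a) λ i i<n →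
  subst (bit i a ≢_) (sym (bit-comp a i<n)) (n≢1∸n (bit<2 i a))

dH-comp′ : ∀ n a → dH n (comp n a) a ≡ n
dH-comp′ n a = dH≡n n (comp n a) a λ i i<n →
  subst (_≢ bit i a) (sym (bit-comp a i<n)) (n≢1∸n (bit<2 i a) ∘ sym)

occ-++ : ∀ c xs ys → occ c (xs ++ ys) ≡ occ c xs + occ c ys
occ-++ c []       ys = refl
occ-++ c (x ∷ xs) ys rewrite occ-++ c xs ys = sym (+-assoc _ (occ c xs) (occ c ys))

occ-∷-≡ : ∀ c xs → occ c (c ∷ xs) ≡ suc (occ c xs)
occ-∷-≡ c xs rewrite ≡ᵇ-refl c = refl

occ-∷-≢ : ∀ {x c} xs → x ≢ c → occ c (x ∷ xs) ≡ occ c xs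
occ-∷-≢ xs x≢c rewrite ≢⇒≡ᵇ≡false x≢c = refl

∈⇒occ>0 : ∀ {c xs} → c ∈ xs → 0 < occ c xs
∈⇒occ>0 {c} {_ ∷ xs} (here refl) rewrite occ-∷-≡ c xs = z<s
∈⇒occ>0          (there c∈xs) = ≤-trans (∈⇒occ>0 c∈xs) (m≤n+m _ _)

occ>0⇒∈ : ∀ {c} xs → 0 < occ c xs → c ∈ xs
occ>0⇒∈ {c} (x ∷ xs) occ>0 with x ≟ c
... | yes refl = here refl
... | no x≢c rewrite occ-∷-≢ xs x≢c = there (occ>0⇒∈ xs occ>0)

∈-MonDivides : ∀ {c M N} → c ∈ M → MonDivides M N → c ∈ N
∈-MonDivides {c} {N = N} c∈M M∣N = occ>0⇒∈ N (≤-trans (∈⇒occ>0 c∈M) (M∣N c))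

∈⇒MonDivides-pair : ∀ {a b N} → a ≢ b → a ∈ N → b ∈ N → MonDivides (a ∷ b ∷ []) N
∈⇒MonDivides-pair {a} {b} a≢b a∈N b∈N c with a ≟ c | b ≟ c
... | yes refl | yes refl = ⊥-elim (a≢b refl)
... | yes refl | no  b≢a  rewrite occ-∷-≡ a (b ∷ []) | occ-∷-≢ [] b≢a = ∈⇒occ>0 a∈N
... | no  a≢c  | yes refl rewrite occ-∷-≢ (b ∷ []) a≢c | occ-∷-≡ b [] = ∈⇒occ>0 b∈N
... | no  a≢c  | no  b≢c  rewrite occ-∷-≢ (b ∷ []) a≢c | occ-∷-≢ [] b≢c = z≤n

ends : ℕ × ℕ → List ℕ
ends (a , b) = a ∷ b ∷ []

endpoints-∷ : ∀ v S → endpoints (v ∷ S) ≡ ends v ++ endpoints S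
endpoints-∷ (a , b) S = refl

endpoints-pair : ∀ v w → endpoints (v ∷ w ∷ []) ≡ ends v ++ ends w
endpoints-pair (a , b) (a′ , b′) = refl

∈-endpoints⁺ : ∀ {c v S} → v ∈ S → c ∈ ends v → c ∈ endpoints S
∈-endpoints⁺ {S = u ∷ S} (here refl) c∈u rewrite endpoints-∷ u S = ∈-++⁺ˡ c∈u
∈-endpoints⁺ {S = u ∷ S} (there v∈S) c∈v rewrite endpoints-∷ u S =
  ∈-++⁺ʳ (ends u) (∈-endpoints⁺ v∈S c∈v)

∈-endpoints⁻ : ∀ {c} S → c ∈ endpoints S → ∃[ v ] v ∈ S × c ∈ ends v
∈-endpoints⁻ (u ∷ S) c∈ rewrite endpoints-∷ u S with ∈-++⁻ (ends u) c∈
... | inj₁ c∈u = u , here refl , c∈u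
... | inj₂ c∈S with ∈-endpoints⁻ S c∈S
...   | v , v∈S , c∈v = v , there v∈S , c∈v

occ-ends≤occ-endpoints : ∀ c {v S} → v ∈ S → occ c (ends v) ≤ occ c (endpoints S)
occ-ends≤occ-endpoints c {S = u ∷ S} v∈
  rewrite endpoints-∷ u S | occ-++ c (ends u) (endpoints S) with v∈
... | here refl  = m≤m+n _ _
... | there v∈S = ≤-trans (occ-ends≤occ-endpoints c v∈S) (m≤n+m _ _)

occ-ends-pair≤occ-endpoints : ∀ c {v w S} → v ∈ S → w ∈ S → v ≢ w →
  occ c (ends v) + occ c (ends w) ≤ occ c (endpoints S)
occ-ends-pair≤occ-endpoints c {v} {w} {u ∷ S} v∈ w∈ v≢w
  rewrite endpoints-∷ u S | occ-++ c (ends u) (endpoints S) with v∈ | w∈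
... | here refl  | here refl  = ⊥-elim (v≢w refl)
... | here refl  | there w∈S =
  +-monoʳ-≤ (occ c (ends v)) (occ-ends≤occ-endpoints c w∈S)
... | there v∈S | here refl  =
  subst (_≤ occ c (ends w) + occ c (endpoints S)) (+-comm (occ c (ends w)) _)
    (+-monoʳ-≤ (occ c (ends w)) (occ-ends≤occ-endpoints c v∈S))
... | there v∈S | there w∈S =
  ≤-trans (occ-ends-pair≤occ-endpoints c v∈S w∈S v≢w) (m≤n+m _ _)

edge-MonDivides : ∀ {v w S} → v ∈ S → w ∈ S → v ≢ w →
  MonDivides (endpoints (v ∷ w ∷ [])) (endpoints S)
edge-MonDivides {v} {w} v∈S w∈S v≢w c
  rewrite endpoints-pair v w | occ-++ c (ends v) (ends w) =
  occ-ends-pair≤occ-endpoints c v∈S w∈S v≢w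

Admissible-antitone : ∀ {n S T} → MonDivides (endpoints T) (endpoints S) →
  Admissible n S → Admissible n T
Admissible-antitone T∣S admS a a< aā∣T = admS a a< λ c → ≤-trans (aā∣T c) (T∣S c)

EdgesAdmissible : ℕ → List (ℕ × ℕ) → Set
EdgesAdmissible n S = ∀ v w → v ∈ S → w ∈ S → v ≢ w → Admissible n (v ∷ w ∷ [])

Admissible⇒EdgesAdmissible : ∀ {n} S → Admissible n S → EdgesAdmissible n S
Admissible⇒EdgesAdmissible {n} S admS v w v∈S w∈S v≢w =
  Admissible-antitone {n} {S} {v ∷ w ∷ []} (edge-MonDivides v∈S w∈S v≢w) admS

NonAntipodal : ℕ → ℕ × ℕ → Set
NonAntipodal n (a , b) = dH n a b < n

vertex⇒NonAntipodal : ∀ {n r} v → IsVertex n r v → NonAntipodal n v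
vertex⇒NonAntipodal (a , b) (_ , _ , _ , dH<n) = dH<n

ends-antipodal : ∀ {n a} v → a ≢ comp n a →
  a ∈ ends v → comp n a ∈ ends v → ¬ NonAntipodal n v
ends-antipodal (x , y) a≢ā (here refl)         (here ā≡x)         = ⊥-elim (a≢ā (sym ā≡x))
ends-antipodal {n} {a} _ _ (here refl)         (there (here refl)) = <-irrefl (dH-comp n a)
ends-antipodal {n} {a} _ _ (there (here refl)) (here refl)         = <-irrefl (dH-comp′ n a)
ends-antipodal (x , y) a≢ā (there (here refl)) (there (here ā≡y)) = ⊥-elim (a≢ā (sym ā≡y))

EdgesAdmissible⇒Admissible : ∀ {n} S → 0 < n → All (NonAntipodal n) S →
  EdgesAdmissible n S → Admissible n S
EdgesAdmissible⇒Admissible {n} S 0<n nonAntipodal edges a a< aā∣S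
  with ∈-endpoints⁻ S (∈-MonDivides {M = a ∷ comp n a ∷ []} (here refl) aā∣S)
     | ∈-endpoints⁻ S (∈-MonDivides {M = a ∷ comp n a ∷ []} (there (here refl)) aā∣S)
... | v , v∈S , a∈v | w , w∈S , ā∈w with ≡-dec _≟_ _≟_ v w
...   | yes refl = ends-antipodal v (comp-≢ {n} a 0<n) a∈v ā∈w (All.lookup nonAntipodal v∈S)
...   | no  v≢w  =
  edges v w v∈S w∈S v≢w a a< (∈⇒MonDivides-pair (comp-≢ {n} a 0<n) a∈vw ā∈vw)
  where
  a∈vw : a ∈ endpoints (v ∷ w ∷ [])
  a∈vw = ∈-endpoints⁺ {S = v ∷ w ∷ []} (here refl) a∈v
  ā∈vw : comp n a ∈ endpoints (v ∷ w ∷ [])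
  ā∈vw = ∈-endpoints⁺ {S = v ∷ w ∷ []} (there (here refl)) ā∈w

mainTheorem12 : (n r : ℕ) → r < n → (S : List (ℕ × ℕ)) → All (IsVertex n r) S → Unique S →
    (Admissible n S ⇔ (∀ v w → v ∈ S → w ∈ S → v ≢ w → Admissible n (v ∷ w ∷ [])))
mainTheorem12 n r r<n S vertices _ =
  mk⇔ (Admissible⇒EdgesAdmissible {n} S)
      (EdgesAdmissible⇒Admissible {n} S (≤-<-trans z≤n r<n)
        (All.map (vertex⇒NonAntipodal {n} {r} _) vertices))
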